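{- Let $n,m,\alpha_1,\dots,\alpha_m,\beta_1,\dots,\beta_m$ be positive integers and set $\alpha=\sum_{i=1}^m\alpha_i$, $\beta=\sum_{i=1}^m\beta_i$. Then the word $U^{\alpha_1}D^{\beta_1}U^{\alpha_2}D^{\beta_2}\cdots U^{\alpha_m}D^{\beta_m}$ is a subword of $(UD)^n$ if and only if $\alpha+\beta-n\leq m\leq n$.
   Context: Words are over the alphabet $\{U,D\}$; $U^{a}$ denotes $a$ consecutive copies of $U$ (similarly for $D$), and $(UD)^n$ denotes $UD$ repeated $n$ times. A word $w$ is a subword of a word $v$ if $w$ can be obtained from $v$ by deleting some letters (not necessarily consecutive) and reading the remaining letters from left to right. -}

module Defs where

open import Data.Nat using (ℕ; zero; suc; _+_)
open import Data.List using (List; []; _∷_; _++_; replicate; concat)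
open import Data.Vec using (Vec; []; _∷_)

data Letter : Set where
  U D : Letter

Word : Set
Word = List Letter

blocks : ∀ {m} → Vec ℕ m → Vec ℕ m → Word
blocks [] [] = []
blocks (a ∷ as) (b ∷ bs) = replicate a U ++ replicate b D ++ blocks as bs

UDpow : ℕ → Word
UDpow zero = []
UDpow (suc n) = U ∷ D ∷ UDpow n

-- A word embeds in (UD)^n exactly when n is at least the number of UD-pairs used
-- by the greedy left-to-right embedding.  Greedily, a block U^a D^b uses a + b − 1
-- pairs (its last U and first D share a pair, while the last D of a block and the
-- first U of the next cannot), so U^{α₁}D^{β₁}⋯U^{αₘ}D^{βₘ} needs exactly α + β − m
-- pairs.  The condition m ≤ n is then automatic, since α, β ≥ m.
module Submission where

open import Defs
open import Data.Nat using (ℕ; zero; suc; _+_; _≤_; _<_; z≤n; s≤s)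
open import Data.Nat.Properties
  using (≤-refl; ≤-trans; n≤1+n; +-mono-≤; +-monoˡ-≤; +-cancelʳ-≤)
open import Data.Nat.Tactic.RingSolver using (solve-∀)
open import Data.List using ([]; _∷_; _++_; replicate)
open import Data.Vec using (Vec; []; _∷_; sum)
open import Data.Vec.Relation.Unary.All using (All; []; _∷_)
open import Data.Product using (_×_; _,_; proj₁)
open import Function.Bundles using (_⇔_; mk⇔)
open import Function.Construct.Composition using (_⇔-∘_)
open import Data.List.Relation.Binary.Sublist.Propositional
  using (_⊆_; []; _∷_; _∷ʳ_; minimum)
open import Relation.Binary.PropositionalEquality
  using (_≡_; refl; cong; subst; sym; module ≡-Reasoning)

-- minUD w is the least n with w ⊆ (UD)^n, and minDUD w the least n with
-- w ⊆ D (UD)^n: the state records whether the next letter of (UD)^∞ is U or D.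
mutual
  minUD : Word → ℕ
  minUD []      = 0
  minUD (U ∷ w) = suc (minDUD w)
  minUD (D ∷ w) = suc (minUD w)

  minDUD : Word → ℕ
  minDUD []      = 0
  minDUD (U ∷ w) = suc (minDUD w)
  minDUD (D ∷ w) = minUD w

minUD≤suc-minDUD : ∀ w → minUD w ≤ suc (minDUD w)
minUD≤suc-minDUD []      = z≤n
minUD≤suc-minDUD (U ∷ w) = n≤1+n _
minUD≤suc-minDUD (D ∷ w) = ≤-refl

minDUD≤minUD : ∀ w → minDUD w ≤ minUD w
minDUD≤minUD []      = z≤n
minDUD≤minUD (U ∷ w) = ≤-refl
minDUD≤minUD (D ∷ w) = n≤1+n _

mutual
  ⊆UDpow⇒minUD≤ : ∀ w n → w ⊆ UDpow n → minUD w ≤ n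
  ⊆UDpow⇒minUD≤ []      n       _          = z≤n
  ⊆UDpow⇒minUD≤ (_ ∷ _) zero    ()
  ⊆UDpow⇒minUD≤ w       (suc n) (.U ∷ʳ p)  =
    ≤-trans (minUD≤suc-minDUD w) (s≤s (⊆DUDpow⇒minDUD≤ w n p))
  ⊆UDpow⇒minUD≤ (U ∷ w) (suc n) (refl ∷ p) = s≤s (⊆DUDpow⇒minDUD≤ w n p)

  ⊆DUDpow⇒minDUD≤ : ∀ w n → w ⊆ D ∷ UDpow n → minDUD w ≤ n
  ⊆DUDpow⇒minDUD≤ []      n _          = z≤n
  ⊆DUDpow⇒minDUD≤ w       n (.D ∷ʳ p)  =
    ≤-trans (minDUD≤minUD w) (⊆UDpow⇒minUD≤ w n p)
  ⊆DUDpow⇒minDUD≤ (D ∷ w) n (refl ∷ p) = ⊆UDpow⇒minUD≤ w n p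

mutual
  minUD≤⇒⊆UDpow : ∀ w n → minUD w ≤ n → w ⊆ UDpow n
  minUD≤⇒⊆UDpow []      n       _       = minimum _
  minUD≤⇒⊆UDpow (U ∷ w) (suc n) (s≤s h) = refl ∷ minDUD≤⇒⊆DUDpow w n h
  minUD≤⇒⊆UDpow (D ∷ w) (suc n) (s≤s h) = U ∷ʳ (refl ∷ minUD≤⇒⊆UDpow w n h)

  minDUD≤⇒⊆DUDpow : ∀ w n → minDUD w ≤ n → w ⊆ D ∷ UDpow n
  minDUD≤⇒⊆DUDpow []      n       _       = minimum _
  minDUD≤⇒⊆DUDpow (D ∷ w) n       h       = refl ∷ minUD≤⇒⊆UDpow w n h
  minDUD≤⇒⊆DUDpow (U ∷ w) (suc n) (s≤s h) = D ∷ʳ (refl ∷ minDUD≤⇒⊆DUDpow w n h)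

⊆UDpow⇔minUD≤ : ∀ w n → (w ⊆ UDpow n) ⇔ (minUD w ≤ n)
⊆UDpow⇔minUD≤ w n = mk⇔ (⊆UDpow⇒minUD≤ w n) (minUD≤⇒⊆UDpow w n)

minDUD-replicateU : ∀ a w → minDUD (replicate a U ++ w) ≡ a + minDUD w
minDUD-replicateU zero    w = refl
minDUD-replicateU (suc a) w = cong suc (minDUD-replicateU a w)

minUD-replicateD : ∀ b w → minUD (replicate b D ++ w) ≡ b + minUD w
minUD-replicateD zero    w = refl
minUD-replicateD (suc b) w = cong suc (minUD-replicateD b w)

minUD-block : ∀ a b w →
  minUD (replicate (suc a) U ++ replicate (suc b) D ++ w) ≡ suc (a + (b + minUD w))
minUD-block a b w = begin
  suc (minDUD (replicate a U ++ replicate (suc b) D ++ w))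
    ≡⟨ cong suc (minDUD-replicateU a _) ⟩
  suc (a + minUD (replicate b D ++ w))
    ≡⟨ cong (λ k → suc (a + k)) (minUD-replicateD b w) ⟩
  suc (a + (b + minUD w)) ∎
  where open ≡-Reasoning

minUD-blocks : ∀ {m} (α β : Vec ℕ m) → All (0 <_) α → All (0 <_) β →
  minUD (blocks α β) + m ≡ sum α + sum β
minUD-blocks []             []             []            []            = refl
minUD-blocks {suc m} (suc a ∷ α) (suc b ∷ β) (s≤s _ ∷ α>0) (s≤s _ ∷ β>0) = begin
  minUD (blocks (suc a ∷ α) (suc b ∷ β)) + suc m
    ≡⟨ cong (_+ suc m) (minUD-block a b (blocks α β)) ⟩
  suc (a + (b + minUD (blocks α β))) + suc m
    ≡⟨ shuffle a b (minUD (blocks α β)) m ⟩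
  suc a + (suc b + (minUD (blocks α β) + m))
    ≡⟨ cong (λ k → suc a + (suc b + k)) (minUD-blocks α β α>0 β>0) ⟩
  suc a + (suc b + (sum α + sum β))
    ≡⟨ interchange (suc a) (suc b) (sum α) (sum β) ⟩
  (suc a + sum α) + (suc b + sum β) ∎
  where
  open ≡-Reasoning
  shuffle : ∀ a b x m → suc (a + (b + x)) + suc m ≡ suc a + (suc b + (x + m))
  shuffle = solve-∀
  interchange : ∀ a b s t → a + (b + (s + t)) ≡ (a + s) + (b + t)
  interchange = solve-∀

length≤sum : ∀ {m} (α : Vec ℕ m) → All (0 <_) α → m ≤ sum α
length≤sum []      []          = z≤n
length≤sum (a ∷ α) (a>0 ∷ α>0) = +-mono-≤ a>0 (length≤sum α α>0)

minUD-blocks≤⇔sum≤ : ∀ {m} n (α β : Vec ℕ m) → All (0 <_) α → All (0 <_) β →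
  (minUD (blocks α β) ≤ n) ⇔ (sum α + sum β ≤ n + m)
minUD-blocks≤⇔sum≤ {m} n α β α>0 β>0 = mk⇔
  (λ h → subst (_≤ n + m) cost (+-monoˡ-≤ m h))
  (λ h → +-cancelʳ-≤ m _ n (subst (_≤ n + m) (sym cost) h))
  where cost = minUD-blocks α β α>0 β>0

mainTheorem2 : (n m : ℕ) → 0 < n → 0 < m →
    (α β : Vec ℕ m) → All (0 <_) α → All (0 <_) β →
    (blocks α β ⊆ UDpow n) ⇔ ((sum α + sum β ≤ n + m) × (m ≤ n))
mainTheorem2 n m _ _ α β α>0 β>0 =
  mk⇔ (λ h → h , m≤n h) proj₁
    ⇔-∘ (minUD-blocks≤⇔sum≤ n α β α>0 β>0 ⇔-∘ ⊆UDpow⇔minUD≤ (blocks α β) n)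
  where
  m≤n : sum α + sum β ≤ n + m → m ≤ n
  m≤n h = +-cancelʳ-≤ m m n (≤-trans (+-mono-≤ (length≤sum α α>0) (length≤sum β β>0)) h)
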